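{- Let $t\ge 4$ be an integer. If $(U_n)_{n\ge1}$ is a family of $K_t$-minor-free graphs such that for every $n$, $U_n$ contains every $n$-vertex $K_t$-minor-free graph as a subgraph, then $|V(U_n)|\ge 2^{(n-t-2)/(t-2)}$ for every $n\ge 1$.
   Context: "$U$ contains $H$ as a subgraph" means $U$ has a subgraph isomorphic to $H$. -}

module Defs where

open import Data.Nat using (ℕ)
open import Data.Bool using (Bool; true; false)
open import Data.Fin using (Fin)
open import Data.Fin.Properties using (_≟_)
open import Data.Maybe using (Maybe; just)
open import Data.Product using (Σ; _×_; ∃; ∃-syntax)
open import Relation.Binary.PropositionalEquality using (_≡_)
open import Relation.Nullary using (¬_; does)
open import Function.Definitions using (Injective)

record Graph : Set where
  field
    V      : ℕ
    adj    : Fin V → Fin V → Bool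
    adj-sym    : ∀ u v → adj u v ≡ adj v u
    adj-irrefl : ∀ u → adj u u ≡ false

open Graph public

Edge : (G : Graph) → Fin (V G) → Fin (V G) → Set
Edge G u v = adj G u v ≡ true

K : ℕ → Graph
K t = record
  { V = t
  ; adj = λ u v → Data.Bool.not (does (u ≟ v))
  ; adj-sym = symK
  ; adj-irrefl = irrK
  }
  where
  open import Relation.Nullary using (yes; no)
  open import Relation.Binary.PropositionalEquality using (refl; sym)
  open import Data.Empty using (⊥-elim)
  irrK : ∀ u → Data.Bool.not (does (u ≟ u)) ≡ false
  irrK u with u ≟ u
  ... | yes _ = refl
  ... | no ne = ⊥-elim (ne refl)
  symK : ∀ u v → Data.Bool.not (does (u ≟ v)) ≡ Data.Bool.not (does (v ≟ u))
  symK u v with u ≟ v | v ≟ u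
  ... | yes _ | yes _ = refl
  ... | no _  | no _  = refl
  ... | yes p | no q  = ⊥-elim (q (sym p))
  ... | no p  | yes q = ⊥-elim (p (sym q))

data WalkIn (G : Graph) (P : Fin (V G) → Set) : Fin (V G) → Fin (V G) → Set where
  here : ∀ {x} → P x → WalkIn G P x x
  step : ∀ {x y z} → P x → Edge G x y → WalkIn G P y z → WalkIn G P x z

-- H is a minor of G: a partial map β : V(G) ⇀ V(H) assigning branch sets
-- β⁻¹(h), which are nonempty, pairwise disjoint (automatic, β is a function),
-- connected in G, and adjacent in G whenever h h' are adjacent in H.
IsMinor : Graph → Graph → Set
IsMinor H G =
  Σ (Fin (V G) → Maybe (Fin (V H))) λ β →
      (∀ h → ∃[ g ] β g ≡ just h)
    × (∀ h g g' → β g ≡ just h → β g' ≡ just h →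
         WalkIn G (λ x → β x ≡ just h) g g')
    × (∀ h h' → Edge H h h' →
         ∃[ g ] ∃[ g' ] (β g ≡ just h × β g' ≡ just h' × Edge G g g'))

KMinorFree : ℕ → Graph → Set
KMinorFree t G = ¬ IsMinor (K t) G

Contains : Graph → Graph → Set
Contains G H =
  Σ (Fin (V H) → Fin (V G)) λ φ →
    Injective _≡_ _≡_ φ × (∀ u v → Edge H u v → Edge G (φ u) (φ v))

-- Write s = t − 2. A strip starts from an s-clique and repeatedly adds a vertex adjacent to the
-- current s-clique (its front), which then replaces one member of the front. Strips have treewidth
-- s, hence are K_t-minor-free, and the n-vertex strips with a fixed first replacement are indexed by
-- m = n − s − 2 free choices in Fin s. Embedded in a K_t-minor-free graph U, a strip is rigid: its
-- choices are determined by the images of the initial clique and of the last vertex, since at a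
-- first difference between two embeddings a K_t minor appears. Hence s ^ m ≤ |U| ^ (s + 1), which
-- gives 2 ^ m ≤ |U| ^ s once s ≥ 3. For s = 2 the images of vertex 0 and of the last vertex already
-- determine those of vertices 1 and 2 up to order, so 2 ^ m ≤ 2 |U| ^ 2.
module Submission where

open import Defs
open import Data.Bool using (true; false)
open import Data.Bool.Properties using (∨-comm)
open import Data.Empty using (⊥; ⊥-elim)
open import Data.Fin as Fin using (Fin; zero; suc; toℕ; fromℕ<; punchIn; combine; funToFin; finToFun)
open import Data.Fin.Properties
  using (_≟_; any?; toℕ<n; toℕ-injective; toℕ-fromℕ<; fromℕ<-toℕ; punchInᵢ≢i; punchIn-injective;
         injective⇒≤; combine-injective; funToFin-finToFin; finToFun-funToFin)
open import Data.List using (List; []; _∷_)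
open import Data.List.Membership.Propositional using (_∈_)
open import Data.List.Relation.Unary.Any using (here; there)
open import Data.Maybe using (Maybe; just; nothing)
open import Data.Maybe.Properties using (just-injective)
import Data.Maybe.Properties as Maybe
open import Data.Nat
  using (ℕ; zero; suc; _+_; _*_; _∸_; _^_; _<_; _≤_; _≤′_; ≤′-refl; ≤′-step; z≤n; s≤s; z<s;
         _<?_; _≤?_)
open import Data.Nat.Properties
  using (≤-refl; ≤-trans; ≤-reflexive; ≤-antisym; <-trans; <-≤-trans; <-irrefl; <-asym; <-cmp;
         <⇒≤; <⇒≱; ≰⇒>; ≮⇒≥; ≤∧≢⇒<; ≤⇒≤′; n≮0; 1+n≰n; n≤1+n; n<1+n; m<n⇒m<1+n; m<1+n⇒m≤n;
         m<1+n⇒m<n∨m≡n;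
         m≤m+n; m<n+m; +-comm; +-suc; +-identityʳ; +-cancelˡ-≡; +-monoʳ-≤; +-monoʳ-<; m+n∸m≡n;
         m∸n+n≡m; m+[n∸m]≡n; m≤n⇒m∸n≡0; ∸-monoˡ-≤; *-comm; *-identityˡ; *-identityʳ; *-mono-≤;
         *-monoˡ-≤; *-monoʳ-≤; ^-monoˡ-≤; ^-monoʳ-≤; ^-monoˡ-<; ^-*-assoc; ^-distribˡ-+-*; ^-zeroˡ;
         module ≤-Reasoning)
open import Data.Nat.Solver using (module +-*-Solver)
open import Data.Product using (_×_; _,_; proj₁; proj₂; ∃-syntax)
open import Data.Sum using (_⊎_; inj₁; inj₂; [_,_])
import Data.Vec.Functional as Vector
open import Function using (_∘_)
open import Relation.Binary using (tri<; tri≈; tri>)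
open import Relation.Binary.PropositionalEquality
  using (_≡_; _≢_; _≗_; refl; sym; trans; cong; cong₂; subst; subst₂; module ≡-Reasoning)
open import Relation.Nullary using (¬_; Dec; yes; no; does)
open import Relation.Nullary.Decidable using (¬?; _×-dec_; _⊎-dec_; dec-true; dec-false; toWitness)

module Walks (G : Graph) where

  Vertex : Set
  Vertex = Fin (V G)

  private variable
    P Q : Vertex → Set
    a b c x : Vertex

  edge-sym : Edge G a b → Edge G b a
  edge-sym {a} {b} e = trans (adj-sym G b a) e

  edge-irrefl : ¬ Edge G a a
  edge-irrefl {a} e with trans (sym e) (adj-irrefl G a)
  ... | ()

  edge⇒≢ : Edge G a b → a ≢ b
  edge⇒≢ e refl = edge-irrefl e

  mapWalk : (∀ {y} → P y → Q y) → WalkIn G P a b → WalkIn G Q a b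
  mapWalk f (here p)     = here (f p)
  mapWalk f (step p e w) = step (f p) e (mapWalk f w)

  infixr 5 _++ʷ_
  _++ʷ_ : WalkIn G P a b → WalkIn G P b c → WalkIn G P a c
  here _     ++ʷ w' = w'
  step p e w ++ʷ w' = step p e (w ++ʷ w')

  source-holds : WalkIn G P a b → P a
  source-holds (here p)     = p
  source-holds (step p _ _) = p

  target-holds : WalkIn G P a b → P b
  target-holds (here p)     = p
  target-holds (step _ _ w) = target-holds w

  reverseWalk : WalkIn G P a b → WalkIn G P b a
  reverseWalk (here p)     = here p
  reverseWalk (step p e w) = reverseWalk w ++ʷ step (source-holds w) (edge-sym e) (here p)

  vertices : WalkIn G P a b → List Vertex
  vertices {a = a} (here _)     = a ∷ []
  vertices {a = a} (step _ _ w) = a ∷ vertices w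

  source∈ : (w : WalkIn G P a b) → a ∈ vertices w
  source∈ (here _)     = here refl
  source∈ (step _ _ _) = here refl

  target∈ : (w : WalkIn G P a b) → b ∈ vertices w
  target∈ (here _)     = here refl
  target∈ (step _ _ w) = there (target∈ w)

  ∈-++ʳ : (w : WalkIn G P a b) (w' : WalkIn G P b c) → x ∈ vertices w' → x ∈ vertices (w ++ʷ w')
  ∈-++ʳ (here _)     w' x∈ = x∈
  ∈-++ʳ (step _ _ w) w' x∈ = there (∈-++ʳ w w' x∈)

  ∈vertices⇒holds : (w : WalkIn G P a b) → x ∈ vertices w → P x
  ∈vertices⇒holds (here p)     (here refl) = p
  ∈vertices⇒holds (step p _ _) (here refl) = p
  ∈vertices⇒holds (step _ _ w) (there x∈) = ∈vertices⇒holds w x∈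

  walk-from-source : (w : WalkIn G P a b) → x ∈ vertices w → WalkIn G (_∈ vertices w) a x
  walk-from-source (here _)     (here refl) = here (here refl)
  walk-from-source (step _ _ _) (here refl) = here (here refl)
  walk-from-source (step _ e w) (there x∈) = step (here refl) e (mapWalk there (walk-from-source w x∈))

  walk-within : (w : WalkIn G P a b) → x ∈ vertices w → c ∈ vertices w → WalkIn G (_∈ vertices w) x c
  walk-within w x∈ c∈ = reverseWalk (walk-from-source w x∈) ++ʷ walk-from-source w c∈

  neighbour-before-target : a ≢ b → WalkIn G P a b →
                            ∃[ x ] WalkIn G (λ y → P y × y ≢ b) a x × Edge G x b
  neighbour-before-target a≢b (here _) = ⊥-elim (a≢b refl)
  neighbour-before-target {b = b} a≢b (step {y = y} p e w) with y ≟ b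
  ... | yes refl = _ , here (p , a≢b) , e
  ... | no y≢b with neighbour-before-target y≢b w
  ...   | x , w' , e' = x , step (p , a≢b) e w' , e'

  first-hit : (R : Vertex → Set) → (∀ y → Dec (R y)) → WalkIn G P a b → ¬ R a →
              WalkIn G (λ y → P y × ¬ R y) a b
            ⊎ ∃[ x ] ∃[ h ] (R h × P h) × WalkIn G (λ y → P y × ¬ R y) a x × Edge G x h
  first-hit R R? (here p) ¬Ra = inj₁ (here (p , ¬Ra))
  first-hit R R? (step {y = y} p e w) ¬Ra with R? y
  ... | yes Ry = inj₂ (_ , y , (Ry , source-holds w) , here (p , ¬Ra) , e)
  ... | no ¬Ry with first-hit R R? w ¬Ry
  ...   | inj₁ w'                       = inj₁ (step (p , ¬Ra) e w')
  ...   | inj₂ (x , h , Rh , w' , e')   = inj₂ (x , h , Rh , step (p , ¬Ra) e w' , e')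

K-edge : ∀ {t} {h h' : Fin t} → h ≢ h' → Edge (K t) h h'
K-edge {h = h} {h'} h≢h' with h ≟ h'
... | yes h≡h' = ⊥-elim (h≢h' h≡h')
... | no _     = refl

K-edge⇒≢ : ∀ {t} {h h' : Fin t} → Edge (K t) h h' → h ≢ h'
K-edge⇒≢ {t} = Walks.edge⇒≢ (K t)

module CliqueMinors (G : Graph) where
  open Walks G

  IsClique : ∀ {k} → (Fin k → Vertex) → Set
  IsClique κ = ∀ i j → i ≢ j → Edge G (κ i) (κ j)

  Avoids : ∀ {k} → (Fin k → Vertex) → Vertex → Set
  Avoids κ x = ∀ i → x ≢ κ i

  Touches : ∀ {k} {P : Vertex → Set} {a b} → WalkIn G P a b → (Fin k → Vertex) → Set
  Touches w κ = ∀ i → ∃[ z ] z ∈ vertices w × Edge G z (κ i)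

  -- Branch sets: the vertices of w, and the singletons {κ i}.
  clique+touching-walk⇒minor : ∀ {s a b} (κ : Fin (suc s) → Vertex) → IsClique κ →
                               (w : WalkIn G (Avoids κ) a b) → Touches w κ → IsMinor (K (2 + s)) G
  clique+touching-walk⇒minor {s} {a} κ κ-clique w touch = branch , nonempty , connected , adjacent
    where
    open import Data.List.Membership.DecPropositional (_≟_ {V G}) using (_∈?_)

    κ-injective : ∀ {i j} → κ i ≡ κ j → i ≡ j
    κ-injective {i} {j} κi≡κj with i ≟ j
    ... | yes i≡j = i≡j
    ... | no i≢j  = ⊥-elim (edge⇒≢ (κ-clique i j i≢j) κi≡κj)

    branch : Vertex → Maybe (Fin (2 + s))
    branch g with any? (λ i → κ i ≟ g) | g ∈? vertices w
    ... | yes (i , _) | _     = just (suc i)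
    ... | no _        | yes _ = just zero
    ... | no _        | no _  = nothing

    branch-κ : ∀ i → branch (κ i) ≡ just (suc i)
    branch-κ i with any? (λ j → κ j ≟ κ i)
    ... | yes (j , κj≡κi) = cong (λ i → just (suc i)) (κ-injective κj≡κi)
    ... | no none         = ⊥-elim (none (i , refl))

    branch-w : ∀ {x} → x ∈ vertices w → branch x ≡ just zero
    branch-w {x} x∈ with any? (λ j → κ j ≟ x) | x ∈? vertices w
    ... | yes (j , κj≡x) | _      = ⊥-elim (∈vertices⇒holds w x∈ j (sym κj≡x))
    ... | no _           | yes _  = refl
    ... | no _           | no x∉ = ⊥-elim (x∉ x∈)

    branch-suc : ∀ {g i} → branch g ≡ just (suc i) → g ≡ κ i
    branch-suc {g} eq with any? (λ j → κ j ≟ g) | g ∈? vertices w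
    ... | yes (j , κj≡g) | _ with refl ← just-injective eq = sym κj≡g
    branch-suc () | no _ | yes _
    branch-suc () | no _ | no _

    branch-zero : ∀ {g} → branch g ≡ just zero → g ∈ vertices w
    branch-zero {g} eq with any? (λ j → κ j ≟ g) | g ∈? vertices w
    branch-zero () | yes _ | _
    ... | no _ | yes g∈ = g∈
    branch-zero () | no _ | no _

    nonempty : ∀ h → ∃[ g ] branch g ≡ just h
    nonempty zero    = a , branch-w (source∈ w)
    nonempty (suc i) = κ i , branch-κ i

    connected : ∀ h g g' → branch g ≡ just h → branch g' ≡ just h →
                WalkIn G (λ x → branch x ≡ just h) g g'
    connected zero g g' eq eq' = mapWalk branch-w (walk-within w (branch-zero eq) (branch-zero eq'))
    connected (suc i) g g' eq eq' with refl ← branch-suc eq | refl ← branch-suc eq' = here (branch-κ i)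

    adjacent : ∀ h h' → Edge (K (2 + s)) h h' →
               ∃[ g ] ∃[ g' ] (branch g ≡ just h × branch g' ≡ just h' × Edge G g g')
    adjacent zero zero ()
    adjacent zero (suc i) _ with z , z∈ , ez ← touch i = z , κ i , branch-w z∈ , branch-κ i , ez
    adjacent (suc i) zero _ with z , z∈ , ez ← touch i = κ i , z , branch-κ i , branch-w z∈ , edge-sym ez
    adjacent (suc i) (suc j) e =
      κ i , κ j , branch-κ i , branch-κ j , κ-clique i j (λ i≡j → K-edge⇒≢ e (cong suc i≡j))

  cone-clique : ∀ {s g} (κ : Fin s → Vertex) → IsClique κ → (∀ i → Edge G g (κ i)) →
                IsClique (g Vector.∷ κ)
  cone-clique κ κ-clique g~κ zero    zero    0≢0 = ⊥-elim (0≢0 refl)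
  cone-clique κ κ-clique g~κ zero    (suc j) _   = g~κ j
  cone-clique κ κ-clique g~κ (suc i) zero    _   = edge-sym (g~κ i)
  cone-clique κ κ-clique g~κ (suc i) (suc j) i≢j = κ-clique i j (λ i≡j → i≢j (cong suc i≡j))

  singleton-clique : ∀ v → IsClique (v Vector.∷ Vector.[])
  singleton-clique v zero zero 0≢0 = ⊥-elim (0≢0 refl)

  -- g is added to the clique, and the walk is stopped just before reaching g.
  linked-common-neighbours⇒minor : ∀ {s g g'} (κ : Fin s → Vertex) → IsClique κ → g' ≢ g →
                                   (∀ i → Edge G g (κ i)) → (∀ i → Edge G g' (κ i)) →
                                   WalkIn G (Avoids κ) g' g → IsMinor (K (2 + s)) G
  linked-common-neighbours⇒minor {s} {g} {g'} κ κ-clique g'≢g g~κ g'~κ w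
    with x , w' , x~g ← neighbour-before-target g'≢g w =
    clique+touching-walk⇒minor (g Vector.∷ κ) (cone-clique κ κ-clique g~κ) (mapWalk avoids⁺ w') touch
    where
    avoids⁺ : ∀ {y} → Avoids κ y × y ≢ g → Avoids (g Vector.∷ κ) y
    avoids⁺ (_ , y≢g) zero    = y≢g
    avoids⁺ (y∉κ , _) (suc i) = y∉κ i

    touch : Touches (mapWalk avoids⁺ w') (g Vector.∷ κ)
    touch zero    = x , target∈ (mapWalk avoids⁺ w') , x~g
    touch (suc i) = g' , source∈ (mapWalk avoids⁺ w') , g'~κ i

-- Read backwards, the vertex order is a perfect elimination ordering in which every vertex has
-- at most s earlier neighbours, all listed by earlier: G has treewidth at most s.
record EliminationOrder (G : Graph) (s : ℕ) : Set where
  field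
    earlier          : Fin (V G) → Fin s → Fin (V G)
    earlier-complete : ∀ {w y} → Edge G w y → y Fin.< w → ∃[ p ] earlier w p ≡ y
    earlier-clique   : ∀ {w y y'} → Edge G w y → Edge G w y' → y Fin.< w → y' Fin.< w → y ≢ y' →
                       Edge G y y'

module _ {G : Graph} {s : ℕ} (elimination : EliminationOrder G s) where
  open EliminationOrder elimination
  open Walks G

  private
    Model : Set
    Model = IsMinor (K (2 + s)) G

    Branches : Set
    Branches = Vertex → Maybe (Fin (2 + s))

  -- The last vertex w used by a model of K_{s+2} can be removed from it; this is impossible when
  -- w is a branch set on its own, since w then needs s + 1 earlier neighbours.
  module LastVertex (M : Model) (w : Vertex)
                    (before-w : ∀ {g h} → proj₁ M g ≡ just h → g ≢ w → g Fin.< w) where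
    private
      β = proj₁ M
      nonempty = proj₁ (proj₂ M)
      connected = proj₁ (proj₂ (proj₂ M))
      adjacent = proj₂ (proj₂ (proj₂ M))

    bypass-w : ∀ {h a b} → a ≢ w → b ≢ w → WalkIn G (λ x → β x ≡ just h) a b →
               WalkIn G (λ x → β x ≡ just h × x ≢ w) a b
    bypass-w a≢w b≢w (here p) = here (p , a≢w)
    bypass-w a≢w b≢w (step {y = y} p e rest) with y ≟ w
    ... | no y≢w = step (p , a≢w) e (bypass-w y≢w b≢w rest)
    bypass-w a≢w b≢w (step p e (here _)) | yes refl = ⊥-elim (b≢w refl)
    bypass-w {a = a} a≢w b≢w (step p e (step {y = z} _ e' rest)) | yes refl with z ≟ w
    ... | yes refl = ⊥-elim (edge-irrefl e')
    ... | no z≢w with a ≟ z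
    ...   | yes refl = bypass-w a≢w b≢w rest
    ...   | no a≢z   = step (p , a≢w) a~z (bypass-w z≢w b≢w rest)
      where
      a~z = earlier-clique (edge-sym e) e' (before-w p a≢w) (before-w (source-holds rest) z≢w) a≢z

    module Remove {h₀ o} (w∈h₀ : β w ≡ just h₀) (o≢w : o ≢ w) (o∈h₀ : β o ≡ just h₀) where

      branch : Branches
      branch g with g ≟ w
      ... | yes _ = nothing
      ... | no _  = β g

      branch-≢ : ∀ {g} → g ≢ w → branch g ≡ β g
      branch-≢ {g} g≢w with g ≟ w
      ... | yes g≡w = ⊥-elim (g≢w g≡w)
      ... | no _    = refl

      branch-just : ∀ {g h} → branch g ≡ just h → g ≢ w × β g ≡ just h
      branch-just {g} eq with g ≟ w
      branch-just () | yes _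
      ... | no g≢w = g≢w , eq

      neighbour : ∃[ x ] β x ≡ just h₀ × x ≢ w × Edge G x w
      neighbour with x , o⇝x , x~w ← neighbour-before-target o≢w (connected h₀ o w o∈h₀ w∈h₀)
                with x∈h₀ , x≢w ← target-holds o⇝x = x , x∈h₀ , x≢w , x~w

      in-h₀ : ∀ {h} → β w ≡ just h → h ≡ h₀
      in-h₀ eq = just-injective (trans (sym eq) w∈h₀)

      different-branches : ∀ {x y h h'} → β x ≡ just h → β y ≡ just h' → h ≢ h' → x ≢ y
      different-branches x∈h y∈h' h≢h' refl = h≢h' (just-injective (trans (sym x∈h) y∈h'))

      reroute : ∀ {h g'} → h₀ ≢ h → β g' ≡ just h → g' ≢ w → Edge G w g' →
                ∃[ x ] branch x ≡ just h₀ × Edge G x g'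
      reroute h₀≢h g'∈h g'≢w w~g' with x , x∈h₀ , x≢w , x~w ← neighbour =
        x , trans (branch-≢ x≢w) x∈h₀ ,
        earlier-clique (edge-sym x~w) w~g' (before-w x∈h₀ x≢w) (before-w g'∈h g'≢w)
                       (different-branches x∈h₀ g'∈h h₀≢h)

      model : Model
      model = branch , nonempty′ , connected′ , adjacent′
        where
        nonempty′ : ∀ h → ∃[ g ] branch g ≡ just h
        nonempty′ h with nonempty h
        ... | g , g∈h with g ≟ w
        ...   | no g≢w = g , trans (branch-≢ g≢w) g∈h
        ...   | yes refl with refl ← in-h₀ g∈h = o , trans (branch-≢ o≢w) o∈h₀

        connected′ : ∀ h g g' → branch g ≡ just h → branch g' ≡ just h →
                     WalkIn G (λ x → branch x ≡ just h) g g'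
        connected′ h g g' g∈h g'∈h
          with g≢w , g∈h ← branch-just g∈h | g'≢w , g'∈h ← branch-just g'∈h =
          mapWalk (λ (x∈h , x≢w) → trans (branch-≢ x≢w) x∈h)
                  (bypass-w g≢w g'≢w (connected h g g' g∈h g'∈h))

        adjacent′ : ∀ h h' → Edge (K (2 + s)) h h' →
                    ∃[ g ] ∃[ g' ] (branch g ≡ just h × branch g' ≡ just h' × Edge G g g')
        adjacent′ h h' h~h' with adjacent h h' h~h'
        ... | g , g' , g∈h , g'∈h' , g~g' with g ≟ w | g' ≟ w
        ...   | no g≢w  | no g'≢w  =
          g , g' , trans (branch-≢ g≢w) g∈h , trans (branch-≢ g'≢w) g'∈h' , g~g'
        ...   | yes refl | yes refl = ⊥-elim (edge-irrefl g~g')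
        ...   | yes refl | no g'≢w with refl ← in-h₀ g∈h
                                   with x , x∈h₀ , x~g' ← reroute (K-edge⇒≢ h~h') g'∈h' g'≢w g~g' =
          x , g' , x∈h₀ , trans (branch-≢ g'≢w) g'∈h' , x~g'
        adjacent′ h h' h~h' | g , g' , g∈h , g'∈h' , g~g' | no g≢w | yes refl
          with refl ← in-h₀ g'∈h'
          with x , x∈h₀ , x~g ← reroute (λ h₀≡h → K-edge⇒≢ h~h' (sym h₀≡h)) g∈h g≢w
                                         (edge-sym g~g') =
          g , x , trans (branch-≢ g≢w) g∈h , x∈h₀ , edge-sym x~g

    lonely⇒⊥ : ∀ {h₀} → β w ≡ just h₀ → (∀ {g} → β g ≡ just h₀ → g ≡ w) → ⊥
    lonely⇒⊥ {h₀} w∈h₀ lonely = 1+n≰n (injective⇒≤ position-injective)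
      where
      contact : ∀ i → ∃[ g ] β g ≡ just (punchIn h₀ i) × ∃[ p ] earlier w p ≡ g
      contact i with adjacent h₀ (punchIn h₀ i) (K-edge (λ h₀≡ → punchInᵢ≢i h₀ i (sym h₀≡)))
      ... | g , g' , g∈h₀ , g'∈h , g~g' with refl ← lonely g∈h₀ =
        g' , g'∈h , earlier-complete g~g' (before-w g'∈h g'≢w)
        where
        g'≢w : g' ≢ w
        g'≢w refl = punchInᵢ≢i h₀ i (just-injective (trans (sym g'∈h) w∈h₀))

      position : Fin (suc s) → Fin s
      position i = proj₁ (proj₂ (proj₂ (contact i)))

      position-injective : ∀ {i j} → position i ≡ position j → i ≡ j
      position-injective {i} {j} eq with contact i | contact j
      ... | g , g∈ , p , refl | g' , g'∈ , p' , refl with refl ← eq =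
        punchIn-injective h₀ i j (just-injective (trans (sym g∈) g'∈))

  private
    Below : Branches → ℕ → Set
    Below β m = ∀ {g h} → β g ≡ just h → toℕ g < m

  no-model-below : ∀ m → m ≤ V G → (M : Model) → Below (proj₁ M) m → ⊥
  no-model-below zero    _   (_ , nonempty , _) below with _ , g∈ ← nonempty zero = n≮0 (below g∈)
  no-model-below (suc m) m<N M below = by-branch-of-w (proj₁ M w) refl
    where
    w : Vertex
    w = fromℕ< m<N

    below-w : ∀ {g h} → proj₁ M g ≡ just h → g ≢ w → toℕ g < m
    below-w g∈h g≢w =
      ≤∧≢⇒< (m<1+n⇒m≤n (below g∈h))
            (λ g≡m → g≢w (toℕ-injective (trans g≡m (sym (toℕ-fromℕ< m<N)))))

    open LastVertex M w (λ g∈h g≢w → subst (_ <_) (sym (toℕ-fromℕ< m<N)) (below-w g∈h g≢w))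

    by-branch-of-w : ∀ b → proj₁ M w ≡ b → ⊥
    by-branch-of-w nothing w∉ = no-model-below m (<⇒≤ m<N) M (λ g∈h → below-w g∈h (w∉⇒≢ g∈h))
      where
      w∉⇒≢ : ∀ {g h} → proj₁ M g ≡ just h → g ≢ w
      w∉⇒≢ g∈h refl with () ← trans (sym w∉) g∈h
    by-branch-of-w (just h₀) w∈h₀
      with any? (λ g → ¬? (g ≟ w) ×-dec Maybe.≡-dec _≟_ (proj₁ M g) (just h₀))
    ... | yes (o , o≢w , o∈h₀) =
      no-model-below m (<⇒≤ m<N) model (λ g∈h → below-w′ (branch-just g∈h))
      where
      open Remove w∈h₀ o≢w o∈h₀
      below-w′ : ∀ {g h} → g ≢ w × proj₁ M g ≡ just h → toℕ g < m
      below-w′ (g≢w , g∈h) = below-w g∈h g≢w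
    ... | no lonely = lonely⇒⊥ w∈h₀ only-w
      where
      only-w : ∀ {g} → proj₁ M g ≡ just h₀ → g ≡ w
      only-w {g} g∈h₀ with g ≟ w
      ... | yes g≡w = g≡w
      ... | no g≢w  = ⊥-elim (lonely (g , g≢w , g∈h₀))

  elimination-order⇒K-minor-free : KMinorFree (2 + s) G
  elimination-order⇒K-minor-free M = no-model-below (V G) ≤-refl M (λ {g} _ → toℕ<n g)

-- Vertices are indexed by ℕ. The vertices 0, …, s − 1 form a clique, and for each k vertex s + k
-- is attached to the s-clique front k, in which it then takes over position σ k.
module Strip (s : ℕ) (σ : ℕ → Fin s) where

  front : ℕ → Fin s → ℕ
  front zero    p = toℕ p
  front (suc k) p with p ≟ σ k
  ... | yes _ = s + k
  ... | no _  = front k p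

  front-hit : ∀ {k p} → p ≡ σ k → front (suc k) p ≡ s + k
  front-hit {k} {p} p≡σk with p ≟ σ k
  ... | yes _   = refl
  ... | no p≢σk = ⊥-elim (p≢σk p≡σk)

  front-miss : ∀ {k p} → p ≢ σ k → front (suc k) p ≡ front k p
  front-miss {k} {p} p≢σk with p ≟ σ k
  ... | yes p≡σk = ⊥-elim (p≢σk p≡σk)
  ... | no _     = refl

  front-< : ∀ k p → front k p < s + k
  front-< zero    p = subst (toℕ p <_) (sym (+-identityʳ s)) (toℕ<n p)
  front-< (suc k) p with p ≟ σ k
  ... | yes _ = +-monoʳ-< s (n<1+n k)
  ... | no _  = <-≤-trans (front-< k p) (+-monoʳ-≤ s (n≤1+n k))

  front-mono : ∀ {k j} p → k ≤ j → front k p ≤ front j p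
  front-mono p k≤j = go (≤⇒≤′ k≤j)
    where
    step-≤ : ∀ k → front k p ≤ front (suc k) p
    step-≤ k with p ≟ σ k
    ... | yes _ = <⇒≤ (front-< k p)
    ... | no _  = ≤-refl
    go : ∀ {k j} → k ≤′ j → front k p ≤ front j p
    go ≤′-refl        = ≤-refl
    go (≤′-step k≤′j) = ≤-trans (go k≤′j) (step-≤ _)

  front-cases : ∀ k p → front k p ≡ toℕ p ⊎ ∃[ j ] σ j ≡ p × front k p ≡ s + j
  front-cases zero    p = inj₁ refl
  front-cases (suc k) p with p ≟ σ k
  ... | yes p≡σk = inj₂ (k , sym p≡σk , refl)
  ... | no _     = front-cases k p

  initial≢new : ∀ {j} (q : Fin s) → toℕ q ≢ s + j
  initial≢new {j} q eq = <-irrefl eq (<-≤-trans (toℕ<n q) (m≤m+n s j))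

  front-position : ∀ k k' {p p'} → front k p ≡ front k' p' → p ≡ p'
  front-position k k' {p} {p'} eq with front-cases k p | front-cases k' p'
  ... | inj₁ fp | inj₁ fp' = toℕ-injective (trans (sym fp) (trans eq fp'))
  ... | inj₁ fp | inj₂ (j , _ , fp') = ⊥-elim (initial≢new p (trans (sym fp) (trans eq fp')))
  ... | inj₂ (j , _ , fp) | inj₁ fp' = ⊥-elim (initial≢new p' (trans (sym fp') (trans (sym eq) fp)))
  ... | inj₂ (j , σj≡p , fp) | inj₂ (j' , σj'≡p' , fp')
        with refl ← +-cancelˡ-≡ s j j' (trans (sym fp) (trans eq fp')) = trans (sym σj≡p) σj'≡p'

  -- Back u v: u is an earlier neighbour of v. For v < s this just says u < v, as front 0 p = p.
  Back : ℕ → ℕ → Set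
  Back u v = u < v × ∃[ p ] front (v ∸ s) p ≡ u

  Adj : ℕ → ℕ → Set
  Adj u v = Back u v ⊎ Back v u

  Back? : ∀ u v → Dec (Back u v)
  Back? u v = u <? v ×-dec any? (λ p → front (v ∸ s) p Data.Nat.≟ u)

  Adj? : ∀ u v → Dec (Adj u v)
  Adj? u v = Back? u v ⊎-dec Back? v u

  Adj-irrefl : ∀ {u} → ¬ Adj u u
  Adj-irrefl (inj₁ (u<u , _)) = <-irrefl refl u<u
  Adj-irrefl (inj₂ (u<u , _)) = <-irrefl refl u<u

  back-initial : ∀ {u v} → u < v → v ≤ s → Back u v
  back-initial {u} {v} u<v v≤s =
    u<v , p , trans (cong (λ k → front k p) (m≤n⇒m∸n≡0 v≤s)) (toℕ-fromℕ< u<s)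
    where
    u<s = <-≤-trans u<v v≤s
    p = fromℕ< u<s

  attach : ∀ k p → Back (front k p) (s + k)
  attach k p = front-< k p , p , cong (λ j → front j p) (m+n∸m≡n s k)

  consecutive : ∀ k → Back (s + k) (s + suc k)
  consecutive k = subst (λ u → Back u (s + suc k)) (front-hit refl) (attach (suc k) (σ k))

  attach-unchanged : ∀ {k p} → p ≢ σ k → Back (front k p) (s + suc k)
  attach-unchanged {k} {p} p≢σk = subst (λ u → Back u (s + suc k)) (front-miss p≢σk) (attach (suc k) p)

  front-clique : ∀ k {p p'} → p ≢ p' → Adj (front k p) (front k p')
  front-clique zero {p} {p'} p≢p' with <-cmp (toℕ p) (toℕ p')
  ... | tri< p<p' _ _ = inj₁ (back-initial p<p' (<⇒≤ (toℕ<n p')))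
  ... | tri≈ _ p≡p' _ = ⊥-elim (p≢p' (toℕ-injective p≡p'))
  ... | tri> _ _ p'<p = inj₂ (back-initial p'<p (<⇒≤ (toℕ<n p)))
  front-clique (suc k) {p} {p'} p≢p' with p ≟ σ k | p' ≟ σ k
  ... | yes p≡σk | yes p'≡σk = ⊥-elim (p≢p' (trans p≡σk (sym p'≡σk)))
  ... | yes _    | no _      = inj₂ (attach k p')
  ... | no _     | yes _     = inj₁ (attach k p)
  ... | no _     | no _      = front-clique k p≢p'

  graph : ℕ → Graph
  graph d = record
    { V          = s + d
    ; adj        = λ u v → does (Adj? (toℕ u) (toℕ v))
    ; adj-sym    = λ u v → ∨-comm (does (Back? (toℕ u) (toℕ v))) (does (Back? (toℕ v) (toℕ u)))
    ; adj-irrefl = λ u → dec-false (Adj? (toℕ u) (toℕ u)) Adj-irrefl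
    }

  module _ {d : ℕ} where

    edge-intro : ∀ {u v} → Adj (toℕ u) (toℕ v) → Edge (graph d) u v
    edge-intro {u} {v} = dec-true (Adj? (toℕ u) (toℕ v))

    edge-elim : ∀ {u v} → Edge (graph d) u v → Adj (toℕ u) (toℕ v)
    edge-elim {u} {v} = from-does (Adj? (toℕ u) (toℕ v))
      where
      from-does : ∀ {A : Set} (a? : Dec A) → does a? ≡ true → A
      from-does (yes a) _  = a
      from-does (no _)  ()

    earlier-back : ∀ {w y} → Edge (graph d) w y → y Fin.< w → Back (toℕ y) (toℕ w)
    earlier-back e y<w with edge-elim e
    ... | inj₁ (w<y , _) = ⊥-elim (<-asym w<y y<w)
    ... | inj₂ yw        = yw

    front-in-graph : ∀ (w : Fin (s + d)) p → front (toℕ w ∸ s) p < s + d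
    front-in-graph w p = <-≤-trans (front-< _ p) (+-monoʳ-≤ s w∸s≤d)
      where
      w∸s≤d : toℕ w ∸ s ≤ d
      w∸s≤d = subst (toℕ w ∸ s ≤_) (m+n∸m≡n s d) (∸-monoˡ-≤ s (<⇒≤ (toℕ<n w)))

    elimination-order : EliminationOrder (graph d) s
    elimination-order = record
      { earlier          = λ w p → fromℕ< (front-in-graph w p)
      ; earlier-complete = complete
      ; earlier-clique   = clique
      }
      where
      complete : ∀ {w y} → Edge (graph d) w y → y Fin.< w → ∃[ p ] fromℕ< (front-in-graph w p) ≡ y
      complete e y<w with _ , p , fp ← earlier-back e y<w =
        p , toℕ-injective (trans (toℕ-fromℕ< _) fp)

      clique : ∀ {w y y'} → Edge (graph d) w y → Edge (graph d) w y' → y Fin.< w → y' Fin.< w →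
               y ≢ y' → Edge (graph d) y y'
      clique {w} e e' y<w y'<w y≢y'
        with _ , p , fp ← earlier-back e y<w | _ , p' , fp' ← earlier-back e' y'<w =
        edge-intro (subst₂ Adj fp fp' (front-clique (toℕ w ∸ s) p≢p'))
        where
        p≢p' : p ≢ p'
        p≢p' refl = y≢y' (toℕ-injective (trans (sym fp) fp'))

  minor-free : ∀ d → KMinorFree (2 + s) (graph d)
  minor-free d = elimination-order⇒K-minor-free elimination-order

module StripEmbedding {s e : ℕ} {σ : ℕ → Fin s} (U : Graph)
                      (emb : Contains U (Strip.graph s σ (suc e))) where
  open Strip s σ public
  open Walks U
  open CliqueMinors U using (IsClique)

  size : ℕ
  size = s + suc e

  last : ℕ
  last = s + e

  new<size : ∀ {k} → k ≤ e → s + k < size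
  new<size k≤e = +-monoʳ-< s (s≤s k≤e)

  front<size : ∀ {k} → k ≤ e → ∀ p → front k p < size
  front<size k≤e p = <-trans (front-< _ p) (new<size k≤e)

  -- Indices ≥ size are sent to the last vertex.
  index : ℕ → Fin size
  index i with i <? size
  ... | yes i<size = fromℕ< i<size
  ... | no _       = fromℕ< (new<size ≤-refl)

  toℕ-index : ∀ {i} → i < size → toℕ (index i) ≡ i
  toℕ-index {i} i<size with i <? size
  ... | yes _     = toℕ-fromℕ< _
  ... | no i≮size = ⊥-elim (i≮size i<size)

  Φ : ℕ → Vertex
  Φ i = proj₁ emb (index i)

  Φ-injective : ∀ {i j} → i < size → j < size → Φ i ≡ Φ j → i ≡ j
  Φ-injective i<size j<size Φi≡Φj =
    trans (sym (toℕ-index i<size)) (trans (cong toℕ (proj₁ (proj₂ emb) Φi≡Φj)) (toℕ-index j<size))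

  Φ-adj : ∀ {i j} → i < size → j < size → Adj i j → Edge U (Φ i) (Φ j)
  Φ-adj i<size j<size ij =
    proj₂ (proj₂ emb) _ _ (edge-intro (subst₂ Adj (sym (toℕ-index i<size)) (sym (toℕ-index j<size)) ij))

  Φ-back : ∀ {i j} → j < size → Back i j → Edge U (Φ i) (Φ j)
  Φ-back j<size ij = Φ-adj (<-trans (proj₁ ij) j<size) j<size (inj₁ ij)

  Φ-attach : ∀ {k} → k ≤ e → ∀ p → Edge U (Φ (s + k)) (Φ (front k p))
  Φ-attach k≤e p = edge-sym (Φ-back (new<size k≤e) (attach _ p))

  Φ-front-clique : ∀ {k} → k ≤ e → IsClique (λ p → Φ (front k p))
  Φ-front-clique {k} k≤e p p' p≢p' = Φ-adj (front<size k≤e p) (front<size k≤e p') (front-clique k p≢p')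

  Φ-consecutive : ∀ {k} → k < e → Edge U (Φ (s + k)) (Φ (s + suc k))
  Φ-consecutive k<e = Φ-back (new<size k<e) (consecutive _)

  Φ-attach-unchanged : ∀ {k p} → k < e → p ≢ σ k → Edge U (Φ (s + suc k)) (Φ (front k p))
  Φ-attach-unchanged k<e p≢σk = edge-sym (Φ-back (new<size k<e) (attach-unchanged p≢σk))

  OnSpine : ℕ → Vertex → Set
  OnSpine k x = ∃[ j ] k ≤ j × j ≤ e × x ≡ Φ (s + j)

  spine : ∀ r {k} → r + k ≡ e → WalkIn U (OnSpine k) (Φ (s + k)) (Φ last)
  spine zero          refl    = here (_ , ≤-refl , ≤-refl , refl)
  spine (suc r) {k} r+k≡e = step (k , ≤-refl , <⇒≤ k<e , refl) (Φ-consecutive k<e)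
                                 (mapWalk later (spine r (trans (+-suc r k) r+k≡e)))
    where
    k<e : k < e
    k<e = subst (k <_) r+k≡e (m<n+m k z<s)
    later : ∀ {x} → OnSpine (suc k) x → OnSpine k x
    later (j , k<j , j≤e , x≡) = j , <⇒≤ k<j , j≤e , x≡

  spine-from : ∀ {k} → k ≤ e → WalkIn U (OnSpine k) (Φ (s + k)) (Φ last)
  spine-from {k} k≤e = spine (e ∸ k) (m∸n+n≡m k≤e)

  spine-avoids : ∀ {k x i} → OnSpine k x → i < s + k → x ≢ Φ i
  spine-avoids (j , k≤j , j≤e , refl) i<s+k Φsj≡Φi =
    <-irrefl (sym s+j≡i) (<-≤-trans i<s+k (+-monoʳ-≤ s k≤j))
    where
    s+j≡i = Φ-injective (new<size j≤e) (<-trans i<s+k (new<size (≤-trans k≤j j≤e))) Φsj≡Φi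

  front<last : ∀ {k} → k ≤ e → ∀ p → front k p < last
  front<last k≤e p = <-≤-trans (front-< _ p) (+-monoʳ-≤ s k≤e)

  Occupant : Fin s → ℕ → Vertex → Set
  Occupant p k x = (∃[ j ] k ≤ j × j ≤ e × x ≡ Φ (front j p)) ⊎ x ≡ Φ last

  occupants : ∀ p r {k} → r + k ≡ e → WalkIn U (Occupant p k) (Φ (front k p)) (Φ last)
  occupants p zero    refl    =
    step (inj₁ (_ , ≤-refl , ≤-refl , refl)) (edge-sym (Φ-attach ≤-refl p)) (here (inj₂ refl))
  occupants p (suc r) {k} r+k≡e =
    extend (p ≟ σ k) (mapWalk later (occupants p r (trans (+-suc r k) r+k≡e)))
    where
    k<e : k < e
    k<e = subst (k <_) r+k≡e (m<n+m k z<s)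

    later : ∀ {x} → Occupant p (suc k) x → Occupant p k x
    later (inj₁ (j , k<j , j≤e , x≡)) = inj₁ (j , <⇒≤ k<j , j≤e , x≡)
    later (inj₂ x≡)                   = inj₂ x≡

    extend : Dec (p ≡ σ k) → WalkIn U (Occupant p k) (Φ (front (suc k) p)) (Φ last) →
             WalkIn U (Occupant p k) (Φ (front k p)) (Φ last)
    extend (no p≢σk)  w = subst (λ i → WalkIn U (Occupant p k) (Φ i) (Φ last)) (front-miss p≢σk) w
    extend (yes p≡σk) w = step (inj₁ (k , ≤-refl , <⇒≤ k<e , refl)) occupant-edge w
      where
      occupant-edge : Edge U (Φ (front k p)) (Φ (front (suc k) p))
      occupant-edge = subst (λ i → Edge U (Φ (front k p)) (Φ i)) (sym (front-hit p≡σk))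
                            (edge-sym (Φ-attach (<⇒≤ k<e) p))

  occupant-avoids-position : ∀ {p k x} → Occupant p k x → ∀ {k'} p' → p' ≢ p → k' ≤ e →
                             x ≢ Φ (front k' p')
  occupant-avoids-position {p} (inj₁ (j , _ , j≤e , refl)) {k'} p' p'≢p k'≤e eq =
    p'≢p (sym (front-position j k' (Φ-injective (front<size j≤e p) (front<size k'≤e p') eq)))
  occupant-avoids-position (inj₂ refl) p' _ k'≤e eq =
    <-irrefl (sym (Φ-injective (new<size ≤-refl) (front<size k'≤e _) eq)) (front<last k'≤e _)

  occupant-avoids-replaced : ∀ {p k x} → Occupant p (suc k) x → σ k ≡ p → k ≤ e → x ≢ Φ (front k p)
  occupant-avoids-replaced {p} {k} (inj₁ (j , k<j , j≤e , refl)) σk≡p k≤e eq =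
    <-irrefl (Φ-injective (front<size k≤e p) (front<size j≤e p) (sym eq)) (<-≤-trans (front-< k p) s+k≤front)
    where
    s+k≤front : s + k ≤ front j p
    s+k≤front = subst (_≤ front j p) (front-hit (sym σk≡p)) (front-mono p k<j)
  occupant-avoids-replaced (inj₂ refl) _ k≤e eq =
    <-irrefl (sym (Φ-injective (new<size ≤-refl) (front<size k≤e _) eq)) (front<last k≤e _)

  occupants-from : ∀ p {k} → k ≤ e → WalkIn U (Occupant p k) (Φ (front k p)) (Φ last)
  occupants-from p {k} k≤e = occupants p (e ∸ k) (m∸n+n≡m k≤e)

  occupants-meet-at-last : ∀ {p p' k k' x} → Occupant p k x → Occupant p' k' x → p ≢ p' → x ≡ Φ last
  occupants-meet-at-last (inj₂ x≡) _ _ = x≡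
  occupants-meet-at-last (inj₁ _) (inj₂ x≡) _ = x≡
  occupants-meet-at-last (inj₁ (j , _ , j≤e , x≡)) on' p≢p' =
    ⊥-elim (occupant-avoids-position on' _ p≢p' j≤e x≡)

-- At a first disagreement, either the two images of vertex s + k are linked common neighbours of the
-- front, or the two spines beyond s + k touch all of the front and s + k.
module Rigidity {s e : ℕ} {U : Graph} (U-free : KMinorFree (2 + s) U) {σ σ' : ℕ → Fin s}
                (emb : Contains U (Strip.graph s σ (suc e))) (emb' : Contains U (Strip.graph s σ' (suc e))) where
  open Walks U
  open CliqueMinors U
  module E  = StripEmbedding U emb
  module E' = StripEmbedding U emb'
  open E using (Φ; front; last)
  open E' using () renaming (Φ to Φ'; front to front')

  AgreeBelow : ℕ → Set
  AgreeBelow k = ∀ j → j < k → σ j ≡ σ' j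

  fronts-agree : ∀ k → AgreeBelow k → ∀ p → front k p ≡ front' k p
  fronts-agree zero    _  p = refl
  fronts-agree (suc k) ag p with p ≟ σ k | p ≟ σ' k
  ... | yes _    | yes _     = refl
  ... | yes p≡σk | no p≢σ'k  = ⊥-elim (p≢σ'k (trans p≡σk (ag k (n<1+n k))))
  ... | no p≢σk  | yes p≡σ'k = ⊥-elim (p≢σk (trans p≡σ'k (sym (ag k (n<1+n k)))))
  ... | no _     | no _      = fronts-agree k (λ j j<k → ag j (m<n⇒m<1+n j<k)) p

  module Step {k} (k<e : k < e) (agree : AgreeBelow k)
              (same-front : ∀ p → Φ (front k p) ≡ Φ' (front k p)) (same-last : Φ last ≡ Φ' last) where

    κ : Fin s → Vertex
    κ p = Φ (front k p)

    κ' : ∀ p → Φ' (front' k p) ≡ κ p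
    κ' p = trans (cong Φ' (sym (fronts-agree k agree p))) (sym (same-front p))

    E'-spine-from : ∀ {j} → j ≤ e → WalkIn U (E'.OnSpine j) (Φ' (s + j)) (Φ last)
    E'-spine-from j≤e = subst (WalkIn U _ _) (sym same-last) (E'.spine-from j≤e)

    same-new : Φ (s + k) ≡ Φ' (s + k)
    same-new with Φ (s + k) ≟ Φ' (s + k)
    ... | yes same = same
    ... | no differ = ⊥-elim (U-free (linked-common-neighbours⇒minor κ (E.Φ-front-clique (<⇒≤ k<e))
                        (λ eq → differ (sym eq)) (E.Φ-attach (<⇒≤ k<e)) g'~κ walk))
      where
      g'~κ : ∀ p → Edge U (Φ' (s + k)) (κ p)
      g'~κ p = subst (Edge U (Φ' (s + k))) (κ' p) (E'.Φ-attach (<⇒≤ k<e) p)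

      walk : WalkIn U (Avoids κ) (Φ' (s + k)) (Φ (s + k))
      walk = mapWalk (λ on p x≡κp → E'.spine-avoids on (E'.front-< k p) (trans x≡κp (sym (κ' p))))
                     (E'-spine-from (<⇒≤ k<e))
          ++ʷ reverseWalk (mapWalk (λ on p → E.spine-avoids on (E.front-< k p)) (E.spine-from (<⇒≤ k<e)))

    same-choice : σ k ≡ σ' k
    same-choice with σ k ≟ σ' k
    ... | yes same = same
    ... | no differ = ⊥-elim (U-free (clique+touching-walk⇒minor κ⁺
                        (cone-clique κ (E.Φ-front-clique (<⇒≤ k<e)) (E.Φ-attach (<⇒≤ k<e))) walk touch))
      where
      κ⁺ : Fin (suc s) → Vertex
      κ⁺ = Φ (s + k) Vector.∷ κ

      avoids : ∀ {x} → E.OnSpine (suc k) x → Avoids κ⁺ x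
      avoids on zero    = E.spine-avoids on (+-monoʳ-< s (n<1+n k))
      avoids on (suc p) = E.spine-avoids on (<-trans (E.front-< k p) (+-monoʳ-< s (n<1+n k)))

      avoids' : ∀ {x} → E'.OnSpine (suc k) x → Avoids κ⁺ x
      avoids' on zero    x≡ = E'.spine-avoids on (+-monoʳ-< s (n<1+n k)) (trans x≡ same-new)
      avoids' on (suc p) x≡ = E'.spine-avoids on (<-trans (E'.front-< k p) (+-monoʳ-< s (n<1+n k)))
                                                 (trans x≡ (sym (κ' p)))

      walk : WalkIn U (Avoids κ⁺) (Φ (s + suc k)) (Φ' (s + suc k))
      walk = mapWalk avoids (E.spine-from k<e) ++ʷ reverseWalk (mapWalk avoids' (E'-spine-from k<e))

      touch : Touches walk κ⁺
      touch zero = _ , source∈ walk , edge-sym (E.Φ-consecutive k<e)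
      touch (suc p) with p ≟ σ k
      ... | no p≢σk  = _ , source∈ walk , E.Φ-attach-unchanged k<e p≢σk
      ... | yes p≡σk = _ , target∈ walk ,
                       subst (Edge U _) (κ' p)
                             (E'.Φ-attach-unchanged k<e (λ p≡σ'k → differ (trans (sym p≡σk) p≡σ'k)))

    same-next-front : ∀ p → Φ (front (suc k) p) ≡ Φ' (front (suc k) p)
    same-next-front p with p ≟ σ k
    ... | yes _ = same-new
    ... | no _  = same-front p

    agree-next : AgreeBelow (suc k)
    agree-next j j<1+k with m<1+n⇒m<n∨m≡n j<1+k
    ... | inj₁ j<k  = agree j j<k
    ... | inj₂ refl = same-choice

  rigid : ∀ r {k} → r + k ≡ e → AgreeBelow k → (∀ p → Φ (front k p) ≡ Φ' (front k p)) →
          Φ last ≡ Φ' last → AgreeBelow e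
  rigid zero    refl  agree _          _         = agree
  rigid (suc r) {k} r+k≡e agree same-front same-last =
    rigid r (trans (+-suc r k) r+k≡e) agree-next same-next-front same-last
    where
    open Step (subst (k <_) r+k≡e (m<n+m k z<s)) agree same-front same-last

  rigid-from : ∀ {k} → k ≤ e → AgreeBelow k → (∀ p → Φ (front k p) ≡ Φ' (front k p)) →
               Φ last ≡ Φ' last → AgreeBelow e
  rigid-from {k} k≤e = rigid (e ∸ k) (m∸n+n≡m k≤e)

-- The configurations found around the triangle 0 1 2 of an embedded strip with s = 2, F being the
-- image of the last vertex: the occupants of the two positions form the legs of a fork, and the spine
-- from vertex 3 a tail.
module Triangles (U : Graph) where
  open Walks U
  open CliqueMinors U

  triangle : Vertex → Vertex → Vertex → Fin 3 → Vertex
  triangle α β γ = α Vector.∷ β Vector.∷ γ Vector.∷ Vector.[]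

  pair : Vertex → Vertex → Fin 2 → Vertex
  pair α x = α Vector.∷ x Vector.∷ Vector.[]

  record Leg (α x y F : Vertex) : Set₁ where
    field
      On        : Vertex → Set
      On-avoids : ∀ {v} → On v → Avoids (pair α x) v
      x~α       : Edge U x α
      y~α       : Edge U y α
      y~x       : Edge U y x
      walk      : WalkIn U On y F

  record Fork (α β γ F : Vertex) : Set₁ where
    field
      leg-β          : Leg α γ β F
      leg-γ          : Leg α β γ F
      legs-meet-at-F : ∀ {v} → Leg.On leg-β v → Leg.On leg-γ v → v ≡ F

  record Tail (α β γ F : Vertex) : Set where
    field
      c    : Vertex
      c~β  : Edge U c β
      c~γ  : Edge U c γ
      walk : WalkIn U (Avoids (triangle α β γ)) c F

  module _ (U-free : KMinorFree 4 U) where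

    legs-agree : ∀ {α x y y' F} → Leg α x y F → Leg α x y' F → y ≡ y'
    legs-agree {α} {x} {y} {y'} {F} l l' with y ≟ y'
    ... | yes y≡y' = y≡y'
    ... | no y≢y'  = ⊥-elim (U-free (linked-common-neighbours⇒minor (pair α x) clique
                       (λ y'≡y → y≢y' (sym y'≡y)) (sees l) (sees l') y'⇝y))
      where
      open Leg
      clique : IsClique (pair α x)
      clique = cone-clique (x Vector.∷ Vector.[]) (singleton-clique x) λ { zero → edge-sym (x~α l) }
      sees : ∀ {z} (m : Leg α x z F) → ∀ i → Edge U z (pair α x i)
      sees m zero       = y~α m
      sees m (suc zero) = y~x m
      y'⇝y : WalkIn U (Avoids (pair α x)) y' y
      y'⇝y = mapWalk (On-avoids l') (walk l') ++ʷ reverseWalk (mapWalk (On-avoids l) (walk l))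

    -- If a leg of f' avoids {β, γ}, it combines with the tail into a connected set touching the
    -- whole triangle; the two legs cannot enter {β, γ} at the same vertex, as they meet only at F.
    module _ {α β γ β' γ' F} (f : Fork α β γ F) (t : Tail α β γ F) (f' : Fork α β' γ' F) where
      open Fork
      open Leg

      private
        Hit : Vertex → Set
        Hit v = v ≡ β ⊎ v ≡ γ

        Hit? : ∀ v → Dec (Hit v)
        Hit? v = (v ≟ β) ⊎-dec (v ≟ γ)

        clique : IsClique (triangle α β γ)
        clique = cone-clique (β Vector.∷ γ Vector.∷ Vector.[])
                   (cone-clique (γ Vector.∷ Vector.[]) (singleton-clique γ)
                                λ { zero → edge-sym (y~x (leg-γ f)) })
                   λ { zero → edge-sym (x~α (leg-γ f)) ; (suc zero) → edge-sym (y~α (leg-γ f)) }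

        avoids : ∀ {x y v} (l : Leg α x y F) → On l v × ¬ Hit v → Avoids (triangle α β γ) v
        avoids l (on , _)    zero             = On-avoids l on zero
        avoids l (_ , ¬hit) (suc zero)       = λ v≡β → ¬hit (inj₁ v≡β)
        avoids l (_ , ¬hit) (suc (suc zero)) = λ v≡γ → ¬hit (inj₂ v≡γ)

        through-tail : ∀ {x y} (l : Leg α x y F) → WalkIn U (λ v → On l v × ¬ Hit v) y F → ⊥
        through-tail l w = U-free (clique+touching-walk⇒minor (triangle α β γ) clique W touch)
          where
          W = mapWalk (avoids l) w ++ʷ reverseWalk (Tail.walk t)
          touch : Touches W (triangle α β γ)
          touch zero             = _ , source∈ W , y~α l
          touch (suc zero)       = _ , target∈ W , Tail.c~β t
          touch (suc (suc zero)) = _ , target∈ W , Tail.c~γ t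

        covered : ∀ {h₁ h₂ u} → Hit h₁ → Hit h₂ → h₁ ≢ h₂ → Hit u → h₁ ≡ u ⊎ h₂ ≡ u
        covered (inj₁ refl) (inj₁ refl) h₁≢h₂ _         = ⊥-elim (h₁≢h₂ refl)
        covered (inj₂ refl) (inj₂ refl) h₁≢h₂ _         = ⊥-elim (h₁≢h₂ refl)
        covered (inj₁ refl) (inj₂ refl) _     (inj₁ refl) = inj₁ refl
        covered (inj₁ refl) (inj₂ refl) _     (inj₂ refl) = inj₂ refl
        covered (inj₂ refl) (inj₁ refl) _     (inj₁ refl) = inj₂ refl
        covered (inj₂ refl) (inj₁ refl) _     (inj₂ refl) = inj₁ refl

        F∉ : ¬ Hit F
        F∉ (inj₁ F≡β) = target-holds (Tail.walk t) (suc zero) F≡β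
        F∉ (inj₂ F≡γ) = target-holds (Tail.walk t) (suc (suc zero)) F≡γ

        both-legs-enter⇒⊥ : ∀ {x₁ h₁ x₂ h₂} → Hit h₁ × On (leg-β f') h₁ → Hit h₂ × On (leg-γ f') h₂ →
                            WalkIn U (λ v → On (leg-β f') v × ¬ Hit v) β' x₁ → Edge U x₁ h₁ →
                            WalkIn U (λ v → On (leg-γ f') v × ¬ Hit v) γ' x₂ → Edge U x₂ h₂ → ⊥
        both-legs-enter⇒⊥ {x₁} {h₁} {x₂} {h₂} (h₁-hit , h₁-on) (h₂-hit , h₂-on) w₁ x₁~h₁ w₂ x₂~h₂
          with h₁ ≟ h₂
        ... | yes refl = F∉ (subst Hit (legs-meet-at-F f' h₁-on h₂-on) h₁-hit)
        ... | no h₁≢h₂ = U-free (clique+touching-walk⇒minor (triangle α β γ) clique W touch)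
          where
          W₁ = mapWalk (avoids (leg-β f')) w₁
          W = reverseWalk W₁ ++ʷ step (source-holds W₁) (edge-sym (y~x (leg-γ f')))
                                      (mapWalk (avoids (leg-γ f')) w₂)

          touch-via : ∀ {u} → h₁ ≡ u ⊎ h₂ ≡ u → ∃[ z ] z ∈ vertices W × Edge U z u
          touch-via (inj₁ refl) = x₁ , source∈ W , x₁~h₁
          touch-via (inj₂ refl) = x₂ , target∈ W , x₂~h₂

          touch : Touches W (triangle α β γ)
          touch zero             = β' , ∈-++ʳ (reverseWalk W₁) _ (here refl) , y~α (leg-β f')
          touch (suc zero)       = touch-via (covered h₁-hit h₂-hit h₁≢h₂ (inj₁ refl))
          touch (suc (suc zero)) = touch-via (covered h₁-hit h₂-hit h₁≢h₂ (inj₂ refl))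

      fork-avoiding-triangle⇒⊥ : ¬ (β' ≡ β ⊎ β' ≡ γ) → ¬ (γ' ≡ β ⊎ γ' ≡ γ) → ⊥
      fork-avoiding-triangle⇒⊥ β'∉ γ'∉
        with first-hit Hit Hit? (walk (leg-β f')) β'∉ | first-hit Hit Hit? (walk (leg-γ f')) γ'∉
      ... | inj₁ w₁ | _       = through-tail (leg-β f') w₁
      ... | inj₂ _  | inj₁ w₂ = through-tail (leg-γ f') w₂
      ... | inj₂ (_ , _ , h₁ , w₁ , x₁~h₁) | inj₂ (_ , _ , h₂ , w₂ , x₂~h₂) =
        both-legs-enter⇒⊥ h₁ h₂ w₁ x₁~h₁ w₂ x₂~h₂

    -- If {β, γ} and {β', γ'} share a vertex x, the two others are legs over the same edge α x.
    forks-agree : ∀ {α β γ β' γ' F} → Fork α β γ F → Tail α β γ F → Fork α β' γ' F →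
                  (β ≡ β' × γ ≡ γ') ⊎ (β ≡ γ' × γ ≡ β')
    forks-agree {β = β} {γ} {β'} {γ'} f t f' with β' ≟ β | β' ≟ γ
    ... | yes refl | _        = inj₁ (refl , legs-agree (Fork.leg-γ f) (Fork.leg-γ f'))
    ... | no _     | yes refl = inj₂ (legs-agree (Fork.leg-β f) (Fork.leg-γ f') , refl)
    ... | no β'≢β  | no β'≢γ with γ' ≟ β | γ' ≟ γ
    ...   | yes refl | _        = ⊥-elim (β'≢γ (sym (legs-agree (Fork.leg-γ f) (Fork.leg-β f'))))
    ...   | no _     | yes refl = ⊥-elim (β'≢β (sym (legs-agree (Fork.leg-β f) (Fork.leg-β f'))))
    ...   | no γ'≢β  | no γ'≢γ  =
      ⊥-elim (fork-avoiding-triangle⇒⊥ f t f' [ β'≢β , β'≢γ ] [ γ'≢β , γ'≢γ ])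

module FirstTriangle {e : ℕ} {σ : ℕ → Fin 2} (U : Graph) (σ0 : σ 0 ≡ zero)
                     (emb : Contains U (Strip.graph 2 σ (2 + e))) where
  open StripEmbedding {s = 2} {e = suc e} {σ = σ} U emb
  open Walks U
  open CliqueMinors U using (Avoids)
  open Triangles U

  front₁-zero : front 1 zero ≡ 2
  front₁-zero = front-hit (sym σ0)

  front₁-one : front 1 (suc zero) ≡ 1
  front₁-one = front-miss (λ 1≡σ0 → 1≢0 (trans 1≡σ0 σ0))
    where
    1≢0 : suc zero ≢ zero
    1≢0 ()

  fork : Fork (Φ 0) (Φ 1) (Φ 2) (Φ last)
  fork = record
    { leg-β          = record
        { On        = Occupant (suc zero) 1
        ; On-avoids = λ { on zero       → occupant-avoids-position on zero (λ ()) z≤n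
                        ; on (suc zero) → subst (_ ≢_) (cong Φ front₁-zero)
                                            (occupant-avoids-position on zero (λ ()) (s≤s z≤n)) }
        ; x~α       = Φ-attach z≤n zero
        ; y~α       = Φ-front-clique z≤n (suc zero) zero (λ ())
        ; y~x       = edge-sym (Φ-attach z≤n (suc zero))
        ; walk      = subst (λ i → WalkIn U (Occupant (suc zero) 1) (Φ i) (Φ last)) front₁-one
                            (occupants-from (suc zero) (s≤s z≤n))
        }
    ; leg-γ          = record
        { On        = Occupant zero 1
        ; On-avoids = λ { on zero       → occupant-avoids-replaced on σ0 z≤n
                        ; on (suc zero) → occupant-avoids-position on (suc zero) (λ ()) z≤n }
        ; x~α       = Φ-front-clique z≤n (suc zero) zero (λ ())
        ; y~α       = Φ-attach z≤n zero
        ; y~x       = Φ-attach z≤n (suc zero)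
        ; walk      = subst (λ i → WalkIn U (Occupant zero 1) (Φ i) (Φ last)) front₁-zero
                            (occupants-from zero (s≤s z≤n))
        }
    ; legs-meet-at-F = λ on on' → occupants-meet-at-last on on' (λ ())
    }

  tail : Tail (Φ 0) (Φ 1) (Φ 2) (Φ last)
  tail = record
    { c    = Φ 3
    ; c~β  = subst (λ i → Edge U (Φ 3) (Φ i)) front₁-one (Φ-attach (s≤s z≤n) (suc zero))
    ; c~γ  = subst (λ i → Edge U (Φ 3) (Φ i)) front₁-zero (Φ-attach (s≤s z≤n) zero)
    ; walk = mapWalk avoids (spine-from (s≤s z≤n))
    }
    where
    avoids : ∀ {x} → OnSpine 1 x → Avoids (triangle (Φ 0) (Φ 1) (Φ 2)) x
    avoids on zero             = spine-avoids on (s≤s z≤n)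
    avoids on (suc zero)       = spine-avoids on (s≤s (s≤s z≤n))
    avoids on (suc (suc zero)) = spine-avoids on (s≤s (s≤s (s≤s z≤n)))

-- σ 0 = p₀ and σ (1 + i) = c i; the junk value p₀ beyond m is never read by a strip with 2 + m new
-- vertices.
choices : ∀ {s m} → Fin s → (Fin m → Fin s) → ℕ → Fin s
choices p₀ c zero = p₀
choices {m = m} p₀ c (suc j) with j <? m
... | yes j<m = c (fromℕ< j<m)
... | no _    = p₀

choices-suc : ∀ {s m} (p₀ : Fin s) (c : Fin m → Fin s) i → choices p₀ c (suc (toℕ i)) ≡ c i
choices-suc {m = m} p₀ c i with toℕ i <? m
... | yes i<m = cong c (fromℕ<-toℕ i i<m)
... | no i≮m  = ⊥-elim (i≮m (toℕ<n i))

choices-injective : ∀ {s m} (p₀ : Fin s) {c c' : Fin m → Fin s} →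
                    (∀ j → j < suc m → choices p₀ c j ≡ choices p₀ c' j) → c ≗ c'
choices-injective p₀ {c} {c'} agree i =
  trans (sym (choices-suc p₀ c i)) (trans (agree _ (s≤s (toℕ<n i))) (choices-suc p₀ c' i))

funToFin-cong : ∀ {m n} {f g : Fin m → Fin n} → f ≗ g → funToFin f ≡ funToFin g
funToFin-cong {zero}  f≗g = refl
funToFin-cong {suc m} f≗g = cong₂ combine (f≗g zero) (funToFin-cong (f≗g ∘ suc))

funToFin-injective : ∀ {m n} {f g : Fin m → Fin n} → funToFin f ≡ funToFin g → f ≗ g
funToFin-injective {f = f} {g} eq i =
  trans (sym (finToFun-funToFin f i)) (trans (cong (λ k → finToFun k i) eq) (finToFun-funToFin g i))

pointwise-injective⇒^≤ : ∀ {m k X} (F : (Fin m → Fin k) → Fin X) →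
                         (∀ {c c'} → F c ≡ F c' → c ≗ c') → k ^ m ≤ X
pointwise-injective⇒^≤ {m} {k} F F-injective = injective⇒≤ λ {i} {j} eq → begin
  i                               ≡⟨ funToFin-finToFin {m} {k} i ⟨
  funToFin (finToFun {k} {m} i)   ≡⟨ funToFin-cong (F-injective eq) ⟩
  funToFin (finToFun {k} {m} j)   ≡⟨ funToFin-finToFin {m} {k} j ⟩
  j                               ∎
  where open ≡-Reasoning

module StripFamily {s m : ℕ} (p₀ : Fin s) (U : Graph) (U-free : KMinorFree (2 + s) U)
                   (emb : (c : Fin m → Fin s) → Contains U (Strip.graph s (choices p₀ c) (2 + m))) where
  private
    module E (c : Fin m → Fin s) = StripEmbedding {s} {suc m} {choices p₀ c} U (emb c)

  encode : (Fin m → Fin s) → Fin (V U ^ s * V U)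
  encode c = combine (funToFin {s} {V U} (λ p → E.Φ c (toℕ p))) (E.Φ c (E.last c))

  encode-injective : ∀ {c c'} → encode c ≡ encode c' → c ≗ c'
  encode-injective {c} {c'} eq with same-initial , same-last ← combine-injective _ _ _ _ eq =
    choices-injective p₀ (Rigidity.rigid-from U-free (emb c) (emb c') z≤n (λ _ ())
                                              (funToFin-injective same-initial) same-last)

  s^m≤N^s*N : s ^ m ≤ V U ^ s * V U
  s^m≤N^s*N = pointwise-injective⇒^≤ encode encode-injective

order-bit : ∀ {N} → Fin N → Fin N → Fin 2
order-bit a b with a Fin.<? b
... | yes _ = zero
... | no _  = suc zero

order-bit-swap : ∀ {N} {a b : Fin N} → a ≢ b → order-bit a b ≢ order-bit b a
order-bit-swap {a = a} {b} a≢b with a Fin.<? b | b Fin.<? a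
... | yes a<b | yes b<a = λ _ → <-asym a<b b<a
... | yes _   | no _    = λ ()
... | no _    | yes _   = λ ()
... | no a≮b  | no b≮a  = λ _ → a≢b (toℕ-injective (≤-antisym (≮⇒≥ b≮a) (≮⇒≥ a≮b)))

-- For s = 2 the images of vertices 0 and last determine those of 1 and 2 up to order (forks-agree),
-- so one bit can replace the image of vertex 1.
module TwoStripFamily {m : ℕ} (U : Graph) (U-free : KMinorFree 4 U)
                      (emb : (c : Fin m → Fin 2) → Contains U (Strip.graph 2 (choices zero c) (2 + m))) where
  private
    module E (c : Fin m → Fin 2) = StripEmbedding {2} {suc m} {choices zero c} U (emb c)
    module T (c : Fin m → Fin 2) = FirstTriangle {m} {choices zero c} U refl (emb c)
    open Triangles U using (Fork; forks-agree)

  encode : (Fin m → Fin 2) → Fin (2 * (V U * V U))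
  encode c = combine (order-bit (E.Φ c 1) (E.Φ c 2)) (combine (E.Φ c 0) (E.Φ c (E.last c)))

  encode-injective : ∀ {c c'} → encode c ≡ encode c' → c ≗ c'
  encode-injective {c} {c'} eq
    with same-order , ends ← combine-injective _ _ _ _ eq
    with same-0 , same-last ← combine-injective _ _ _ _ ends
    with forks-agree U-free (T.fork c) (T.tail c)
                     (subst₂ (λ α F → Fork α (E.Φ c' 1) (E.Φ c' 2) F) (sym same-0) (sym same-last)
                             (T.fork c'))
  ... | inj₁ (same-1 , same-2) =
    choices-injective zero
      (Rigidity.rigid-from U-free (emb c) (emb c') (s≤s z≤n) agree₀ same-front₁ same-last)
    where
    agree₀ : ∀ j → j < 1 → choices zero c j ≡ choices zero c' j
    agree₀ zero    _         = refl
    agree₀ (suc j) (s≤s ())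

    same-front₁ : ∀ p → E.Φ c (E.front c 1 p) ≡ E.Φ c' (E.front c 1 p)
    same-front₁ zero       rewrite T.front₁-zero c = same-2
    same-front₁ (suc zero) rewrite T.front₁-one c  = same-1
  ... | inj₂ (1↦2 , 2↦1) =
    ⊥-elim (order-bit-swap Φ1≢Φ2 (trans same-order (cong₂ order-bit (sym 2↦1) (sym 1↦2))))
    where
    Φ1≢Φ2 : E.Φ c 1 ≢ E.Φ c 2
    Φ1≢Φ2 eq with () ← E.Φ-injective c (s≤s (s≤s z≤n)) (s≤s (s≤s (s≤s z≤n))) eq

  2^m≤2*N^2 : 2 ^ m ≤ 2 * V U ^ 2
  2^m≤2*N^2 = subst (λ N² → 2 ^ m ≤ 2 * (V U * N²)) (sym (*-identityʳ (V U)))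
                    (pointwise-injective⇒^≤ encode encode-injective)

^-cancelʳ-≤ : ∀ k {a b} → a ^ suc k ≤ b ^ suc k → a ≤ b
^-cancelʳ-≤ k {a} {b} a^k≤b^k with a ≤? b
... | yes a≤b = a≤b
... | no a≰b  = ⊥-elim (<⇒≱ (^-monoˡ-< (suc k) (≰⇒> a≰b)) a^k≤b^k)

^-swapʳ : ∀ a b c → (a ^ b) ^ c ≡ (a ^ c) ^ b
^-swapʳ a b c = trans (^-*-assoc a b c) (trans (cong (a ^_) (*-comm b c)) (sym (^-*-assoc a c b)))

2^[1+s]≤s^s : ∀ s → 3 ≤ s → 2 ^ suc s ≤ s ^ s
2^[1+s]≤s^s 1 (s≤s ())
2^[1+s]≤s^s 2 (s≤s (s≤s ()))
2^[1+s]≤s^s 3 _ = toWitness {a? = 2 ^ 4 ≤? 3 ^ 3} _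
2^[1+s]≤s^s (suc s@(suc (suc (suc _)))) _ = begin
  2 ^ suc (suc s)     ≤⟨ *-monoʳ-≤ 2 (2^[1+s]≤s^s s (s≤s (s≤s (s≤s z≤n)))) ⟩
  2 * s ^ s           ≤⟨ *-mono-≤ {2} {suc s} (s≤s (s≤s z≤n)) (^-monoˡ-≤ s (n≤1+n s)) ⟩
  suc s ^ suc s       ∎
  where open ≤-Reasoning

2^m≤N^s : ∀ {s N m} → 3 ≤ s → s ^ m ≤ N ^ s * N → 2 ^ m ≤ N ^ s
2^m≤N^s {s} {N} {m} 3≤s s^m≤N^s*N = ^-cancelʳ-≤ s (begin
  (2 ^ m) ^ suc s     ≡⟨ ^-swapʳ 2 m (suc s) ⟩
  (2 ^ suc s) ^ m     ≤⟨ ^-monoˡ-≤ m (2^[1+s]≤s^s s 3≤s) ⟩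
  (s ^ s) ^ m         ≡⟨ ^-swapʳ s s m ⟩
  (s ^ m) ^ s         ≤⟨ ^-monoˡ-≤ s s^m≤N^s*N ⟩
  (N ^ s * N) ^ s     ≡⟨ cong (_^ s) (*-comm (N ^ s) N) ⟩
  (N ^ suc s) ^ s     ≡⟨ ^-swapʳ N (suc s) s ⟩
  (N ^ s) ^ suc s     ∎)
  where open ≤-Reasoning

2^m≤2*N^s⇒bound : ∀ {s N m} → 2 ^ m ≤ 2 * N ^ s → 2 ^ (s + (2 + m)) ≤ N ^ s * 2 ^ (2 + s + 2)
2^m≤2*N^s⇒bound {s} {N} {m} 2^m≤2*N^s = begin
  2 ^ (s + (2 + m))                   ≡⟨ ^-distribˡ-+-* 2 s (2 + m) ⟩
  2 ^ s * (2 * (2 * 2 ^ m))           ≤⟨ *-monoʳ-≤ (2 ^ s) (*-monoʳ-≤ 2 (*-monoʳ-≤ 2 2^m≤2*N^s)) ⟩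
  2 ^ s * (2 * (2 * (2 * N ^ s)))     ≡⟨ rearrange (2 ^ s) (N ^ s) ⟩
  N ^ s * 2 ^ (3 + s)                 ≤⟨ *-monoʳ-≤ (N ^ s) (^-monoʳ-≤ 2 3+s≤2+s+2) ⟩
  N ^ s * 2 ^ (2 + s + 2)             ∎
  where
  open ≤-Reasoning
  open +-*-Solver using (solve; _:*_; _:=_; con)
  rearrange : ∀ P X → P * (2 * (2 * (2 * X))) ≡ X * (2 * (2 * (2 * P)))
  rearrange = solve 2 (λ P X → P :* (con 2 :* (con 2 :* (con 2 :* X)))
                            := X :* (con 2 :* (con 2 :* (con 2 :* P)))) refl
  3+s≤2+s+2 : 3 + s ≤ 2 + s + 2
  3+s≤2+s+2 = s≤s (s≤s (≤-trans (n≤1+n (suc s)) (≤-reflexive (+-comm 2 s))))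

small-n-bound : ∀ {s N n} → n ≤ 2 + s → 1 ≤ N → 2 ^ n ≤ N ^ s * 2 ^ (2 + s + 2)
small-n-bound {s} {N} {n} n≤2+s 1≤N = begin
  2 ^ n                       ≤⟨ ^-monoʳ-≤ 2 (≤-trans n≤2+s (m≤m+n (2 + s) 2)) ⟩
  2 ^ (2 + s + 2)             ≡⟨ *-identityˡ _ ⟨
  1 * 2 ^ (2 + s + 2)         ≤⟨ *-monoˡ-≤ (2 ^ (2 + s + 2)) 1≤N^s ⟩
  N ^ s * 2 ^ (2 + s + 2)     ∎
  where
  open ≤-Reasoning
  1≤N^s : 1 ≤ N ^ s
  1≤N^s = subst (_≤ N ^ s) (^-zeroˡ s) (^-monoˡ-≤ s 1≤N)

strips⇒2^m≤2*N^s : ∀ {s m} {U : Graph} → 2 ≤ s → KMinorFree (2 + s) U →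
                   (∀ p₀ (c : Fin m → Fin s) → Contains U (Strip.graph s (choices p₀ c) (2 + m))) →
                   2 ^ m ≤ 2 * V U ^ s
strips⇒2^m≤2*N^s {1} (s≤s ())
strips⇒2^m≤2*N^s {2}     {m} {U} _ U-free emb = TwoStripFamily.2^m≤2*N^2 {m} U U-free (emb zero)
strips⇒2^m≤2*N^s {suc (suc (suc s))} {m} {U} _ U-free emb =
  ≤-trans (2^m≤N^s {N = V U} {m} (s≤s (s≤s (s≤s z≤n)))
                   (StripFamily.s^m≤N^s*N zero U U-free (emb zero)))
          (m≤m+n (V U ^ suc (suc (suc s))) _)

edgeless : ℕ → Graph
edgeless n = record { V = n ; adj = λ _ _ → false ; adj-sym = λ _ _ → refl ; adj-irrefl = λ _ → refl }

edgeless-K-minor-free : ∀ s n → KMinorFree (2 + s) (edgeless n)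
edgeless-K-minor-free s n (_ , _ , _ , adjacent) with _ , _ , _ , _ , () ← adjacent zero (suc zero) refl

corollary4p7 : (t : ℕ) → 4 ≤ t → (U : ℕ → Graph) →
    (∀ n → 1 ≤ n → KMinorFree t (U n)) →
    (∀ n → 1 ≤ n → (H : Graph) → V H ≡ n → KMinorFree t H → Contains (U n) H) →
    ∀ n → 1 ≤ n → 2 ^ n ≤ V (U n) ^ (t ∸ 2) * 2 ^ (t + 2)
corollary4p7 (suc (suc s)) (s≤s (s≤s 2≤s)) U U-free universal n 1≤n with n ≤? 2 + s
... | yes n≤t =
  small-n-bound n≤t (nonempty 1≤n (proj₁ (universal n 1≤n (edgeless n) refl (edgeless-K-minor-free s n))))
  where
  nonempty : ∀ {k N} → 1 ≤ k → (Fin k → Fin N) → 1 ≤ N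
  nonempty {suc _} _ f = ≤-trans (s≤s z≤n) (toℕ<n (f zero))
... | no n≰t = subst (λ k → 2 ^ k ≤ V (U n) ^ s * 2 ^ (2 + s + 2)) size≡n
                     (2^m≤2*N^s⇒bound {s} {V (U n)} {m} (strips⇒2^m≤2*N^s 2≤s (U-free n 1≤n) embed))
  where
  m : ℕ
  m = n ∸ (2 + s)

  size≡n : s + (2 + m) ≡ n
  size≡n = trans (trans (+-suc s (suc m)) (cong suc (+-suc s m))) (m+[n∸m]≡n (<⇒≤ (≰⇒> n≰t)))

  embed : ∀ p₀ (c : Fin m → Fin s) → Contains (U n) (Strip.graph s (choices p₀ c) (2 + m))
  embed p₀ c = universal n 1≤n _ size≡n (Strip.minor-free s (choices p₀ c) (2 + m))
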